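{- Let $n\geq 2$ be an integer, let $A$ be a non-empty subset of $\mathbb Z_n'$, and let $S$ be a sequence in $\mathbb Z_n$. Then $S$ is an $E$-extremal sequence for $(A,\mathbb Z_n')$ if and only if $S$ is an $E$-extremal sequence for $A$.
   Context: $\mathbb Z_n=\mathbb Z/n\mathbb Z$ as a module over itself and $\mathbb Z_n'=\mathbb Z_n\setminus\{0\}$. A subsequence is a non-empty subfamily of terms in the original order. A sequence $(x_1,\ldots,x_k)$ is an $A$-weighted zero-sum sequence if there exist $a_i\in A$ with $\sum a_ix_i=0$, and an $(A,B)$-weighted zero-sum sequence if there exist $a_i\in A$, $b_i\in B$ with $\sum a_ix_i=0$ and $\sum b_ia_i=0$. $E_{A,B}(n)$ (resp. $E_A(n)$) is the least positive $k$ such that every sequence of length $k$ in $\mathbb Z_n$ has an $(A,B)$-weighted (resp. $A$-weighted) zero-sum subsequence of length $n$. An $E$-extremal sequence for $(A,B)$ (resp. for $A$) is a sequence of length $E_{A,B}(n)-1$ (resp. $E_A(n)-1$) having no $(A,B)$-weighted (resp. $A$-weighted) zero-sum subsequence of length $n$. -}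

module Defs where

open import Level using (0ℓ)
open import Data.Nat using (ℕ; suc; _*_; _≤_; _<_)
open import Data.Nat.Divisibility using (_∣_)
open import Data.Fin using (Fin; toℕ)
open import Data.List using (List; length; lookup; tabulate)
open import Data.Nat.ListAction using (sum)
open import Data.List.Relation.Binary.Sublist.Propositional as SL using ()
open import Data.Product using (Σ; _×_; ∃)
open import Relation.Binary.PropositionalEquality using (_≡_; _≢_)
open import Relation.Nullary using (¬_)
open import Relation.Unary using (Pred; _∈_)

-- ℤ_n is represented by Fin n (residues 0,…,n-1); an equation "∑ = 0 in ℤ_n"
-- is expressed as n ∣ (the sum of representatives computed in ℕ).

ℤ' : (n : ℕ) → Pred (Fin n) 0ℓ
ℤ' n x = toℕ x ≢ 0

∑ : {k : ℕ} → (Fin k → ℕ) → ℕ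
∑ {k} f = sum (tabulate {n = k} f)

AWZS : {n : ℕ} → Pred (Fin n) 0ℓ → List (Fin n) → Set
AWZS {n} A T =
  Σ (Fin (length T) → Fin n) λ a →
    (∀ i → a i ∈ A) × (n ∣ ∑ (λ i → toℕ (a i) * toℕ (lookup T i)))

ABWZS : {n : ℕ} → Pred (Fin n) 0ℓ → Pred (Fin n) 0ℓ → List (Fin n) → Set
ABWZS {n} A B T =
  Σ (Fin (length T) → Fin n) λ a →
    (∀ i → a i ∈ A) × (n ∣ ∑ (λ i → toℕ (a i) * toℕ (lookup T i))) ×
    Σ (Fin (length T) → Fin n) λ b →
      (∀ i → b i ∈ B) × (n ∣ ∑ (λ i → toℕ (b i) * toℕ (a i)))

HasSub : {n : ℕ} → (List (Fin n) → Set) → List (Fin n) → Set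
HasSub {n} P S = Σ (List (Fin n)) λ T → (T SL.⊆ S) × (length T ≡ n) × P T

AllHaveSub : {n : ℕ} → (List (Fin n) → Set) → ℕ → Set
AllHaveSub {n} P k = (S : List (Fin n)) → length S ≡ k → HasSub P S

IsE : {n : ℕ} → (List (Fin n) → Set) → ℕ → Set
IsE P k = (1 ≤ k) × AllHaveSub P k × (∀ k' → 1 ≤ k' → k' < k → ¬ AllHaveSub P k')

Extremal : {n : ℕ} → (List (Fin n) → Set) → List (Fin n) → Set
Extremal P S = ∃ λ k → IsE P k × (suc (length S) ≡ k) × ¬ HasSub P S

-- The constraint ∑ bᵢ aᵢ = 0 with all bᵢ ≠ 0 can always be met for n ≥ 2 nonzero
-- residues a₁, …, aₙ: a pair (x, y) is killed by the weights (−y, x), and when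
-- n ≥ 3 a triple is killed as well, so splitting the n terms into pairs and at
-- most one triple gives the weights.  Hence a length-n sequence is an
-- (A, ℤₙ')-weighted zero-sum sequence exactly when it is an A-weighted one, and
-- E-extremality only depends on the length-n instances of the zero-sum property.
module Submission where

open import Algebra.Properties.CommutativeSemigroup using (x∙yz≈z∙yx; x∙yz≈y∙xz)
open import Data.Empty using (⊥-elim)
open import Data.Fin using (Fin; zero; suc; toℕ; fromℕ<)
open import Data.Fin.Properties using (toℕ<n; toℕ-fromℕ<)
open import Data.List using (List; length)
open import Data.List.Properties using (tabulate-cong)
open import Data.Nat
open import Data.Nat.Divisibility using (_∣_; ∣m∣n⇒∣m+n; m∣m*n)
open import Data.Nat.ListAction using (sum)
open import Data.Nat.Properties
open import Data.Product using (Σ; ∃₂; _×_; _,_; proj₁; proj₂)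
open import Data.Sum using (_⊎_; inj₁; inj₂)
open import Data.Vec.Functional using ([]; _∷_)
open import Function.Bundles using (_⇔_; mk⇔; Equivalence)
open import Level using (0ℓ)
open import Relation.Binary.PropositionalEquality
open import Relation.Binary.Definitions using (tri<; tri≈; tri>)
open import Relation.Nullary using (yes; no)
open import Relation.Unary using (Pred; Satisfiable; _⊆_)

open import Defs

∑-cong : ∀ {k} {f g : Fin k → ℕ} → (∀ i → f i ≡ g i) → ∑ f ≡ ∑ g
∑-cong f≗g = cong sum (tabulate-cong f≗g)

[r∸p]*q+q*p≡r*q : ∀ {p r} q → p ≤ r → (r ∸ p) * q + q * p ≡ r * q
[r∸p]*q+q*p≡r*q {p} {r} q p≤r = begin
  (r ∸ p) * q + q * p ≡⟨ cong ((r ∸ p) * q +_) (*-comm q p) ⟩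
  (r ∸ p) * q + p * q ≡⟨ *-distribʳ-+ q (r ∸ p) p ⟨
  (r ∸ p + p) * q     ≡⟨ cong (_* q) (m∸n+n≡m p≤r) ⟩
  r * q               ∎
  where open ≡-Reasoning

module Weights (n : ℕ) where

  NonzeroResidue : ℕ → Set
  NonzeroResidue v = 0 < v × v < n

  NonzeroResidue-neg : ∀ {y} → NonzeroResidue y → NonzeroResidue (n ∸ y)
  NonzeroResidue-neg (0<y , y<n) = m<n⇒0<n∸m y<n , ∸-monoʳ-< 0<y (<⇒≤ y<n)

  NonzeroResidue-∸ : ∀ {p r} → p < r → r < n → NonzeroResidue (r ∸ p)
  NonzeroResidue-∸ {p} {r} p<r r<n = m<n⇒0<n∸m p<r , ≤-<-trans (m∸n≤m r p) r<n

  ZeroSumWeights : ∀ {m} → (Fin m → ℕ) → Set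
  ZeroSumWeights {m} a =
    Σ (Fin m → ℕ) λ β → (∀ i → NonzeroResidue (β i)) × n ∣ ∑ (λ i → β i * a i)

  Weights₂ : ℕ → ℕ → Set
  Weights₂ x y = ∃₂ λ u v → NonzeroResidue u × NonzeroResidue v × n ∣ u * x + v * y

  Weights₃ : ℕ → ℕ → ℕ → Set
  Weights₃ x y z = Σ ℕ λ u → ∃₂ λ v w →
    NonzeroResidue u × NonzeroResidue v × NonzeroResidue w × n ∣ u * x + (v * y + w * z)

  weights₂ : ∀ {x y} → NonzeroResidue x → NonzeroResidue y → Weights₂ x y
  weights₂ {x} {y} x∈ y∈ = n ∸ y , x , NonzeroResidue-neg y∈ , x∈ ,
    subst (n ∣_) (sym ([r∸p]*q+q*p≡r*q x (<⇒≤ (proj₂ y∈)))) (m∣m*n x)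

  -- q·p + (r − p)·q + (−q)·r = r·q − q·r = 0
  weights₃-< : ∀ {p q r} → p < r → NonzeroResidue q → NonzeroResidue r → Weights₃ p q r
  weights₃-< {p} {q} {r} p<r q∈ r∈ =
    q , r ∸ p , n ∸ q , q∈ , NonzeroResidue-∸ p<r (proj₂ r∈) , NonzeroResidue-neg q∈ ,
    subst (n ∣_) (sym sum≡n*r) (m∣m*n r)
    where
    open ≡-Reasoning
    sum≡n*r : q * p + ((r ∸ p) * q + (n ∸ q) * r) ≡ n * r
    sum≡n*r = begin
      q * p + ((r ∸ p) * q + (n ∸ q) * r) ≡⟨ +-assoc (q * p) _ _ ⟨
      q * p + (r ∸ p) * q + (n ∸ q) * r   ≡⟨ cong (_+ (n ∸ q) * r) (+-comm (q * p) _) ⟩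
      (r ∸ p) * q + q * p + (n ∸ q) * r   ≡⟨ cong (_+ (n ∸ q) * r) ([r∸p]*q+q*p≡r*q q (<⇒≤ p<r)) ⟩
      r * q + (n ∸ q) * r                 ≡⟨ +-comm (r * q) _ ⟩
      (n ∸ q) * r + r * q                 ≡⟨ [r∸p]*q+q*p≡r*q r (<⇒≤ (proj₂ q∈)) ⟩
      n * r                               ∎

  weights₃-≢ : ∀ {p q r} → p ≢ r →
               NonzeroResidue p → NonzeroResidue q → NonzeroResidue r → Weights₃ p q r
  weights₃-≢ {p} {q} {r} p≢r p∈ q∈ r∈ with <-cmp p r
  ... | tri< p<r _ _ = weights₃-< p<r q∈ r∈
  ... | tri≈ _ p≡r _ = ⊥-elim (p≢r p≡r)
  ... | tri> _ _ r<p with weights₃-< r<p q∈ p∈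
  ...   | u , v , w , u∈ , v∈ , w∈ , n∣sum =
    w , v , u , w∈ , v∈ , u∈ ,
    subst (n ∣_) (x∙yz≈z∙yx +-commutativeSemigroup (u * r) (v * q) (w * p)) n∣sum

  weights₃-const : 3 ≤ n → ∀ {x} → Weights₃ x x x
  weights₃-const 3≤n {x} = 1 , 1 , n ∸ 2 , 1∈ , 1∈ , NonzeroResidue-neg (z<s , 3≤n) ,
    subst (n ∣_) (sym sum≡n*x) (m∣m*n x)
    where
    1∈ : NonzeroResidue 1
    1∈ = z<s , <-trans (s≤s z<s) 3≤n
    open ≡-Reasoning
    sum≡n*x : 1 * x + (1 * x + (n ∸ 2) * x) ≡ n * x
    sum≡n*x = begin
      1 * x + (1 * x + (n ∸ 2) * x) ≡⟨ cong (λ y → y + (y + (n ∸ 2) * x)) (*-identityˡ x) ⟩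
      (2 + (n ∸ 2)) * x             ≡⟨ cong (_* x) (m+[n∸m]≡n (<⇒≤ 3≤n)) ⟩
      n * x                         ∎

  weights₃ : 3 ≤ n → ∀ {x y z} →
             NonzeroResidue x → NonzeroResidue y → NonzeroResidue z → Weights₃ x y z
  weights₃ 3≤n {x} {y} {z} x∈ y∈ z∈ with x ≟ z
  ... | no x≢z = weights₃-≢ x≢z x∈ y∈ z∈
  ... | yes refl with y ≟ x
  ...   | yes refl = weights₃-const 3≤n
  ...   | no y≢x with weights₃-≢ y≢x y∈ x∈ x∈
  ...     | u , v , w , u∈ , v∈ , w∈ , n∣sum =
    v , u , w , v∈ , u∈ , w∈ ,
    subst (n ∣_) (x∙yz≈y∙xz +-commutativeSemigroup (u * y) (v * x) (w * x)) n∣sum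

  NonzeroResidue-∷ : ∀ {k u} {β : Fin k → ℕ} → NonzeroResidue u →
                     (∀ i → NonzeroResidue (β i)) → ∀ i → NonzeroResidue ((u ∷ β) i)
  NonzeroResidue-∷ u∈ β∈ zero    = u∈
  NonzeroResidue-∷ u∈ β∈ (suc i) = β∈ i

  -- For n = 2 the only weight is 1, so only an even number of terms can be killed.
  zeroSumWeights : ∀ m → 2 ≤ m → 3 ≤ n ⊎ m ≡ 2 →
                   (a : Fin m → ℕ) → (∀ i → NonzeroResidue (a i)) → ZeroSumWeights a
  zeroSumWeights 1 (s≤s ()) _ _ _
  zeroSumWeights 2 _ _ a a∈ with weights₂ (a∈ zero) (a∈ (suc zero))
  ... | u , v , u∈ , v∈ , n∣sum =
    u ∷ v ∷ [] , NonzeroResidue-∷ u∈ (NonzeroResidue-∷ v∈ λ ()) ,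
    subst (n ∣_) (cong (u * a zero +_) (sym (+-identityʳ _))) n∣sum
  zeroSumWeights 3 _ (inj₁ 3≤n) a a∈
    with weights₃ 3≤n (a∈ zero) (a∈ (suc zero)) (a∈ (suc (suc zero)))
  ... | u , v , w , u∈ , v∈ , w∈ , n∣sum =
    u ∷ v ∷ w ∷ [] , NonzeroResidue-∷ u∈ (NonzeroResidue-∷ v∈ (NonzeroResidue-∷ w∈ λ ())) ,
    subst (n ∣_) (cong (λ s → u * a zero + (v * a (suc zero) + s)) (sym (+-identityʳ _))) n∣sum
  zeroSumWeights (suc (suc (suc (suc k)))) _ (inj₁ 3≤n) a a∈
    with weights₂ (a∈ zero) (a∈ (suc zero))
       | zeroSumWeights (2 + k) (s≤s (s≤s z≤n)) (inj₁ 3≤n) (λ i → a (suc (suc i))) (λ i → a∈ (suc (suc i)))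
  ... | u , v , u∈ , v∈ , n∣pair | β , β∈ , n∣rest =
    u ∷ v ∷ β , NonzeroResidue-∷ u∈ (NonzeroResidue-∷ v∈ β∈) ,
    subst (n ∣_) (+-assoc (u * a zero) _ _) (∣m∣n⇒∣m+n n∣pair n∣rest)

module _ {n : ℕ} where

  _⇒ₙ_ : (P Q : List (Fin n) → Set) → Set
  P ⇒ₙ Q = ∀ T → length T ≡ n → P T → Q T

  variable
    P Q : List (Fin n) → Set

  HasSub-mono : P ⇒ₙ Q → ∀ S → HasSub P S → HasSub Q S
  HasSub-mono P⇒Q S (T , T⊆S , |T|≡n , PT) = T , T⊆S , |T|≡n , P⇒Q T |T|≡n PT

  AllHaveSub-mono : P ⇒ₙ Q → ∀ k → AllHaveSub P k → AllHaveSub Q k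
  AllHaveSub-mono P⇒Q k allP S |S|≡k = HasSub-mono P⇒Q S (allP S |S|≡k)

  IsE-transfer : P ⇒ₙ Q → Q ⇒ₙ P → ∀ k → IsE P k → IsE Q k
  IsE-transfer P⇒Q Q⇒P k (1≤k , allP , minimal) =
    1≤k , AllHaveSub-mono P⇒Q k allP ,
    λ k′ 1≤k′ k′<k allQ → minimal k′ 1≤k′ k′<k (AllHaveSub-mono Q⇒P k′ allQ)

  Extremal-transfer : P ⇒ₙ Q → Q ⇒ₙ P → ∀ S → Extremal P S → Extremal Q S
  Extremal-transfer P⇒Q Q⇒P S (k , isE , |S|<k , noP) =
    k , IsE-transfer P⇒Q Q⇒P k isE , |S|<k , λ hasQ → noP (HasSub-mono Q⇒P S hasQ)

  Extremal-cong : (∀ T → length T ≡ n → P T ⇔ Q T) → ∀ S → Extremal P S ⇔ Extremal Q S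
  Extremal-cong {P = P} {Q = Q} P⇔Q S =
    mk⇔ (Extremal-transfer P⇒Q Q⇒P S) (Extremal-transfer Q⇒P P⇒Q S)
    where
    P⇒Q : P ⇒ₙ Q
    P⇒Q T |T|≡n = Equivalence.to (P⇔Q T |T|≡n)
    Q⇒P : Q ⇒ₙ P
    Q⇒P T |T|≡n = Equivalence.from (P⇔Q T |T|≡n)

ABWZS-ℤ'⇔AWZS : ∀ {n} → 2 ≤ n → (A : Pred (Fin n) 0ℓ) → A ⊆ ℤ' n →
                ∀ T → length T ≡ n → ABWZS A (ℤ' n) T ⇔ AWZS A T
ABWZS-ℤ'⇔AWZS {n} 2≤n A A⊆ℤ' T |T|≡n = mk⇔ (λ (a , a∈A , n∣∑ax , _) → a , a∈A , n∣∑ax) AWZS⇒ABWZS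
  where
  open Weights n

  lengthCondition : 3 ≤ n ⊎ length T ≡ 2
  lengthCondition with n ≟ 2
  ... | yes n≡2 = inj₂ (trans |T|≡n n≡2)
  ... | no n≢2  = inj₁ (≤∧≢⇒< 2≤n (≢-sym n≢2))

  AWZS⇒ABWZS : AWZS A T → ABWZS A (ℤ' n) T
  AWZS⇒ABWZS (a , a∈A , n∣∑ax)
    with zeroSumWeights (length T) (subst (2 ≤_) (sym |T|≡n) 2≤n) lengthCondition
           (λ i → toℕ (a i)) (λ i → n≢0⇒n>0 (A⊆ℤ' (a∈A i)) , toℕ<n (a i))
  ... | β , β∈ , n∣∑βa = a , a∈A , n∣∑ax , b , b∈ℤ' ,
    subst (n ∣_) (∑-cong λ i → cong (_* toℕ (a i)) (sym (toℕ-fromℕ< (proj₂ (β∈ i))))) n∣∑βa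
    where
    b : Fin (length T) → Fin n
    b i = fromℕ< (proj₂ (β∈ i))
    b∈ℤ' : ∀ i → ℤ' n (b i)
    b∈ℤ' i rewrite toℕ-fromℕ< (proj₂ (β∈ i)) = >⇒≢ (proj₁ (β∈ i))

theorem22 : (n : ℕ) → 2 ≤ n → (A : Pred (Fin n) 0ℓ) → Satisfiable A → A ⊆ ℤ' n →
    (S : List (Fin n)) →
    Extremal (ABWZS A (ℤ' n)) S ⇔ Extremal (AWZS A) S
theorem22 n 2≤n A _ A⊆ℤ' = Extremal-cong (ABWZS-ℤ'⇔AWZS 2≤n A A⊆ℤ')
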